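{- The graph $C^+$ has no $K_{2,4}$ minor.
   Context: $C^+$ is the graph with vertex set $\{v_1,\ldots,v_8\}$ and the $13$ edges $v_1v_2, v_1v_3, v_2v_3, v_1v_7, v_2v_8, v_3v_6, v_4v_5$, and $v_iv_j$ for all $i \in \{4,5\}$, $j \in \{6,7,8\}$. Minors are taken in the usual sense for simple graphs (parallel edges and loops removed after contraction). -}

module Defs where

open import Data.Nat using (ℕ)
open import Data.Fin using (Fin; zero; suc)
open import Data.Maybe using (Maybe; just; nothing)
open import Data.Product using (Σ; ∃; _×_; _,_)
open import Data.Sum using (_⊎_)
open import Data.Empty using (⊥)
open import Relation.Nullary using (¬_)
open import Relation.Binary.PropositionalEquality using (_≡_)
open import Data.Bool using (Bool; true; false; T; _∨_; _∧_; not)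
open import Data.Fin using (_≟_)
open import Relation.Nullary.Decidable using (⌊_⌋)

record Graph (n : ℕ) : Set₁ where
  field
    Adj   : Fin n → Fin n → Set
    sym   : ∀ {u v} → Adj u v → Adj v u
    irrefl : ∀ {u} → ¬ Adj u u
open Graph public

data WalkIn {n : ℕ} (G : Graph n) (P : Fin n → Set) : Fin n → Fin n → Set where
  here : ∀ {u} → P u → WalkIn G P u u
  step : ∀ {u w v} → P u → Adj G u w → WalkIn G P w v → WalkIn G P u v

-- A minor model of H in G (standard definition of "H is a minor of G"):
-- a partial map φ : V(G) ⇀ V(H) whose fibres (branch sets) are nonempty,
-- pairwise disjoint (automatic), induce connected subgraphs of G, and for
-- each edge hh' of H there is an edge of G between the branch sets of h, h'.
record MinorModel {m n : ℕ} (H : Graph m) (G : Graph n) : Set where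
  field
    φ         : Fin n → Maybe (Fin m)
    nonempty  : ∀ h → ∃ λ v → φ v ≡ just h
    connected : ∀ h u v → φ u ≡ just h → φ v ≡ just h →
                WalkIn G (λ w → φ w ≡ just h) u v
    edges     : ∀ h h' → Adj H h h' →
                ∃ λ u → ∃ λ v → φ u ≡ just h × φ v ≡ just h' × Adj G u v

_IsMinorOf_ : ∀ {m n} → Graph m → Graph n → Set
H IsMinorOf G = MinorModel H G

_≠ᵇ_ : ∀ {n} → Fin n → Fin n → Bool
u ≠ᵇ v = not ⌊ u ≟ v ⌋

fromEdges : ∀ {n} → (Fin n → Fin n → Bool) → Graph n
fromEdges e = record
  { Adj    = λ u v → T ((e u v ∨ e v u) ∧ (u ≠ᵇ v))
  ; sym    = λ {u} {v} p → symP u v p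
  ; irrefl = λ {u} p → irrP u p
  }
  where
  open import Data.Bool.Properties using (∨-comm)
  open import Relation.Binary.PropositionalEquality using (subst; refl)
  ≠ᵇ-sym : ∀ {n} (u v : Fin n) → (u ≠ᵇ v) ≡ (v ≠ᵇ u)
  ≠ᵇ-sym u v with u ≟ v | v ≟ u
  ... | Relation.Nullary.yes _ | Relation.Nullary.yes _ = refl
  ... | Relation.Nullary.no _  | Relation.Nullary.no _  = refl
  ... | Relation.Nullary.yes p | Relation.Nullary.no q = Data.Empty.⊥-elim (q (Relation.Binary.PropositionalEquality.sym p))
  ... | Relation.Nullary.no p  | Relation.Nullary.yes q = Data.Empty.⊥-elim (p (Relation.Binary.PropositionalEquality.sym q))
  symP : ∀ u v → T ((e u v ∨ e v u) ∧ (u ≠ᵇ v)) → T ((e v u ∨ e u v) ∧ (v ≠ᵇ u))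
  symP u v p rewrite ∨-comm (e u v) (e v u) | ≠ᵇ-sym u v = p
  irrP : ∀ u → ¬ T ((e u u ∨ e u u) ∧ (u ≠ᵇ u))
  irrP u p with u ≟ u
  ... | Relation.Nullary.yes _ with e u u
  ...   | true = p
  ...   | false = p
  irrP u p | Relation.Nullary.no q = q refl

K24-edge : Fin 6 → Fin 6 → Bool
K24-edge zero       (suc (suc _)) = true
K24-edge (suc zero) (suc (suc _)) = true
K24-edge _          _             = false

K₂,₄ : Graph 6
K₂,₄ = fromEdges K24-edge

v₁ v₂ v₃ v₄ v₅ v₆ v₇ v₈ : Fin 8
v₁ = zero
v₂ = suc zero
v₃ = suc (suc zero)
v₄ = suc (suc (suc zero))
v₅ = suc (suc (suc (suc zero)))
v₆ = suc (suc (suc (suc (suc zero))))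
v₇ = suc (suc (suc (suc (suc (suc zero)))))
v₈ = suc (suc (suc (suc (suc (suc (suc zero))))))

C⁺-edge : Fin 8 → Fin 8 → Bool
C⁺-edge u v =
  is v₁ v₂ ∨ is v₁ v₃ ∨ is v₂ v₃ ∨ is v₁ v₇ ∨ is v₂ v₈ ∨ is v₃ v₆ ∨ is v₄ v₅ ∨
  is v₄ v₆ ∨ is v₄ v₇ ∨ is v₄ v₈ ∨ is v₅ v₆ ∨ is v₅ v₇ ∨ is v₅ v₈
  where
  is : Fin 8 → Fin 8 → Bool
  is a b = ⌊ u ≟ a ⌋ ∧ ⌊ v ≟ b ⌋

C⁺ : Graph 8
C⁺ = fromEdges C⁺-edge

-- In a K₂,₄ model the branch sets A and B of the two degree-4 vertices are disjoint, and since
-- each induces a connected subgraph, every vertex of A that is not alone in A has a neighbour in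
-- A (likewise for B). Each of the four remaining branch sets is joined to A by an edge, and the
-- ends of these edges outside A are four distinct vertices outside A ∪ B adjacent to A; likewise
-- for B. An exhaustive search over all pairs of vertex subsets shows that C⁺ has no such pair.

module Submission where

open import Defs
open import Data.Bool using (T; _∨_; _∧_)
import Data.Bool.Properties as Bool
open import Data.Empty using (⊥-elim)
open import Data.Fin using (Fin; zero; suc; _≟_)
open import Data.Fin.Properties using (all?; any?; suc-injective; 0≢1+n)
open import Data.Fin.Subset
  using (Subset; _∈_; _∉_; _∩_; _∪_; _-_; ∣_∣; ⊥; ⁅_⁆)
open import Data.Fin.Subset.Properties
  using (_∈?_; Empty-unique; anySubset?; x∈p∩q⁻; x∈p∪q⁻; x∈p∧x≢y⇒x∈p-y; x∈p⇒∣p-x∣<∣p∣)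
open import Data.Maybe using (just)
open import Data.Maybe.Properties using (just-injective) renaming (≡-dec to ≡-decᴹ)
open import Data.Nat using (zero; suc; _≤_; _≤?_; z≤n; s≤s)
open import Data.Nat.Properties using (≤-trans)
open import Data.Product using (∃; ∃₂; _×_; _,_; proj₁; proj₂)
open import Data.Sum using (inj₁; inj₂)
open import Data.Vec using ([]; _∷_; lookup; tabulate)
open import Data.Vec.Properties
  using (lookup∘tabulate; lookup⇒[]=; []=⇒lookup) renaming (≡-dec to ≡-decⱽ)
open import Function using (_∘_)
open import Function.Definitions using (Injective)
open import Relation.Binary using (Decidable)
open import Relation.Binary.PropositionalEquality using (_≡_; _≢_; refl; trans; subst)
import Relation.Binary.PropositionalEquality as ≡
open import Relation.Nullary using (¬_; Dec; does; proof; ¬?; _×-dec_; _→-dec_)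
open import Relation.Nullary.Decidable using (T?; map′; from-yes; from-no; dec-true)
open import Relation.Nullary.Reflects using (Reflects; invert)
open import Relation.Unary using (Pred)
import Relation.Unary as U

injective⇒≤∣p∣ : ∀ {k n} {p : Subset n} (f : Fin k → Fin n) →
                 Injective _≡_ _≡_ f → (∀ i → f i ∈ p) → k ≤ ∣ p ∣
injective⇒≤∣p∣ {zero}         f f-inj f∈p = z≤n
injective⇒≤∣p∣ {suc k} {p = p} f f-inj f∈p =
  ≤-trans (s≤s (injective⇒≤∣p∣ (f ∘ suc) (suc-injective ∘ f-inj) f-suc∈p-f₀))
          (x∈p⇒∣p-x∣<∣p∣ (f∈p zero))
  where
  f-suc∈p-f₀ : ∀ i → f (suc i) ∈ p - f zero
  f-suc∈p-f₀ i = x∈p∧x≢y⇒x∈p-y (f∈p (suc i)) (λ eq → 0≢1+n (≡.sym (f-inj eq)))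

module _ {n p} {P : Pred (Fin n) p} (P? : U.Decidable P) where

  satisfying : Subset n
  satisfying = tabulate (does ∘ P?)

  ∈-satisfying⁺ : ∀ {x} → P x → x ∈ satisfying
  ∈-satisfying⁺ {x} px =
    lookup⇒[]= x satisfying (trans (lookup∘tabulate _ x) (dec-true (P? x) px))

  ∈-satisfying⁻ : ∀ {x} → x ∈ satisfying → P x
  ∈-satisfying⁻ {x} x∈ =
    invert (subst (Reflects (P x)) (trans (≡.sym (lookup∘tabulate _ x)) ([]=⇒lookup x∈))
                  (proof (P? x)))

walk-leaves : ∀ {n} {G : Graph n} {P u v} → WalkIn G P u v → u ≢ v →
              ∃ λ w → P w × Adj G u w
walk-leaves (here _)          u≢u = ⊥-elim (u≢u refl)
walk-leaves (step _ u~w w⇝v) _   = _ , source w⇝v , u~w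
  where
  source : ∀ {n} {G : Graph n} {P u v} → WalkIn G P u v → P u
  source (here pu)     = pu
  source (step pu _ _) = pu

-- A weakening of connectivity (equivalent to it for sets of at most three vertices) that is
-- all the search needs and is cheap to decide.
Linked : ∀ {n} → Graph n → Subset n → Set
Linked G S = ∀ u v → u ∈ S → v ∈ S → u ≢ v → ∃ λ w → w ∈ S × Adj G u w

module _ {n} (G : Graph n) (adj? : Decidable (Adj G)) where

  linked? : U.Decidable (Linked G)
  linked? S = all? λ u → all? λ v → u ∈? S →-dec v ∈? S →-dec ¬? (u ≟ v) →-dec
              any? λ w → w ∈? S ×-dec adj? u w

  Borders : Subset n → Subset n → Pred (Fin n) _
  Borders S R v = v ∉ R × ∃ λ u → u ∈ S × Adj G u v

  borders? : ∀ S R → U.Decidable (Borders S R)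
  borders? S R v = ¬? (v ∈? R) ×-dec any? λ u → u ∈? S ×-dec adj? u v

  frontier : Subset n → Subset n → Subset n
  frontier S R = satisfying (borders? S R)

  ∈-frontier⁺ : ∀ {S R u v} → v ∉ R → u ∈ S → Adj G u v → v ∈ frontier S R
  ∈-frontier⁺ {S} {R} v∉R u∈S u~v = ∈-satisfying⁺ (borders? S R) (v∉R , _ , u∈S , u~v)

  record HubPair (A B : Subset n) : Set where
    field
      disjoint : A ∩ B ≡ ⊥
      spreadᴬ  : 4 ≤ ∣ frontier A (A ∪ B) ∣
      spreadᴮ  : 4 ≤ ∣ frontier B (A ∪ B) ∣
      linkedᴬ  : Linked G A
      linkedᴮ  : Linked G B

  -- Disjointness is tested first, being cheap and passed by only 3ⁿ of the 4ⁿ pairs of subsets.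
  hubPair? : ∀ A B → Dec (HubPair A B)
  hubPair? A B = map′ (λ (d , sa , sb , la , lb) → record
                        { disjoint = d ; spreadᴬ = sa ; spreadᴮ = sb ; linkedᴬ = la ; linkedᴮ = lb })
                      (λ h → let open HubPair h in disjoint , spreadᴬ , spreadᴮ , linkedᴬ , linkedᴮ)
                      (≡-decⱽ Bool._≟_ (A ∩ B) ⊥ ×-dec 4 ≤? ∣ frontier A (A ∪ B) ∣ ×-dec
                       4 ≤? ∣ frontier B (A ∪ B) ∣ ×-dec linked? A ×-dec linked? B)

leg : Fin 4 → Fin 6
leg x = suc (suc x)

module _ {n} {G : Graph n} (adj? : Decidable (Adj G)) (M : K₂,₄ IsMinorOf G) where
  open MinorModel M

  branch : Fin 6 → Subset n
  branch h = satisfying λ u → ≡-decᴹ _≟_ (φ u) (just h)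

  hubs : Subset n
  hubs = branch zero ∪ branch (suc zero)

  ∈-branch⁺ : ∀ {h u} → φ u ≡ just h → u ∈ branch h
  ∈-branch⁺ {h} = ∈-satisfying⁺ (λ u → ≡-decᴹ _≟_ (φ u) (just h))

  ∈-branch⁻ : ∀ {h u} → u ∈ branch h → φ u ≡ just h
  ∈-branch⁻ {h} = ∈-satisfying⁻ (λ u → ≡-decᴹ _≟_ (φ u) (just h))

  branch-unique : ∀ {h h' u} → u ∈ branch h → u ∈ branch h' → h ≡ h'
  branch-unique u∈h u∈h' = just-injective (trans (≡.sym (∈-branch⁻ u∈h)) (∈-branch⁻ u∈h'))

  branches-disjoint : ∀ {h h' u} → h ≢ h' → u ∈ branch h → u ∉ branch h'
  branches-disjoint h≢h' u∈h u∈h' = h≢h' (branch-unique u∈h u∈h')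

  branch-linked : ∀ h → Linked G (branch h)
  branch-linked h u v u∈ v∈ u≢v =
    let (w , φw , u~w) = walk-leaves (connected h u v (∈-branch⁻ u∈) (∈-branch⁻ v∈)) u≢v
    in w , ∈-branch⁺ φw , u~w

  leg∉hubs : ∀ {x u} → u ∈ branch (leg x) → u ∉ hubs
  leg∉hubs u∈leg u∈hubs with x∈p∪q⁻ (branch zero) _ u∈hubs
  ... | inj₁ u∈0 = branches-disjoint (λ ()) u∈0 u∈leg
  ... | inj₂ u∈1 = branches-disjoint (λ ()) u∈1 u∈leg

  hub-spread : ∀ h → (∀ x → Adj K₂,₄ h (leg x)) → 4 ≤ ∣ frontier G adj? (branch h) hubs ∣
  hub-spread h h~leg = injective⇒≤∣p∣ foot foot-injective foot-borders
    where
    edge : ∀ x → ∃₂ λ u v → φ u ≡ just h × φ v ≡ just (leg x) × Adj G u v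
    edge x = edges h (leg x) (h~leg x)

    foot : Fin 4 → Fin n
    foot x = proj₁ (proj₂ (edge x))

    foot∈leg : ∀ x → foot x ∈ branch (leg x)
    foot∈leg x = let (_ , _ , _ , φv , _) = edge x in ∈-branch⁺ φv

    foot-injective : Injective _≡_ _≡_ foot
    foot-injective {x} {y} fx≡fy = suc-injective (suc-injective
      (branch-unique (foot∈leg x) (subst (_∈ branch (leg y)) (≡.sym fx≡fy) (foot∈leg y))))

    foot-borders : ∀ x → foot x ∈ frontier G adj? (branch h) hubs
    foot-borders x = let (_ , _ , φu , φv , u~v) = edge x
                     in ∈-frontier⁺ G adj? (leg∉hubs (∈-branch⁺ φv)) (∈-branch⁺ φu) u~v

  hubPair : HubPair G adj? (branch zero) (branch (suc zero))
  hubPair = record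
    { disjoint = Empty-unique λ (u , u∈∩) → let (u∈0 , u∈1) = x∈p∩q⁻ (branch zero) _ u∈∩
                                            in branches-disjoint (λ ()) u∈0 u∈1
    ; spreadᴬ  = hub-spread zero (λ _ → _)
    ; spreadᴮ  = hub-spread (suc zero) (λ _ → _)
    ; linkedᴬ  = branch-linked zero
    ; linkedᴮ  = branch-linked (suc zero)
    }

-- Deciding adjacency through this table instead of through C⁺-edge keeps the search fast.
C⁺-neighbours : Fin 8 → Subset 8
C⁺-neighbours = lookup
  ( ⁅ v₂ ⁆ ∪ ⁅ v₃ ⁆ ∪ ⁅ v₇ ⁆
  ∷ ⁅ v₁ ⁆ ∪ ⁅ v₃ ⁆ ∪ ⁅ v₈ ⁆
  ∷ ⁅ v₁ ⁆ ∪ ⁅ v₂ ⁆ ∪ ⁅ v₆ ⁆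
  ∷ ⁅ v₅ ⁆ ∪ ⁅ v₆ ⁆ ∪ ⁅ v₇ ⁆ ∪ ⁅ v₈ ⁆
  ∷ ⁅ v₄ ⁆ ∪ ⁅ v₆ ⁆ ∪ ⁅ v₇ ⁆ ∪ ⁅ v₈ ⁆
  ∷ ⁅ v₃ ⁆ ∪ ⁅ v₄ ⁆ ∪ ⁅ v₅ ⁆
  ∷ ⁅ v₁ ⁆ ∪ ⁅ v₄ ⁆ ∪ ⁅ v₅ ⁆
  ∷ ⁅ v₂ ⁆ ∪ ⁅ v₄ ⁆ ∪ ⁅ v₅ ⁆
  ∷ [])

C⁺-neighbours-correct : ∀ u v →
  lookup (C⁺-neighbours u) v ≡ (C⁺-edge u v ∨ C⁺-edge v u) ∧ (u ≠ᵇ v)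
C⁺-neighbours-correct = from-yes (all? λ u → all? λ v →
  lookup (C⁺-neighbours u) v Bool.≟ ((C⁺-edge u v ∨ C⁺-edge v u) ∧ (u ≠ᵇ v)))

C⁺-adj? : Decidable (Adj C⁺)
C⁺-adj? u v = map′ (subst T (C⁺-neighbours-correct u v))
                   (subst T (≡.sym (C⁺-neighbours-correct u v)))
                   (T? (lookup (C⁺-neighbours u) v))

C⁺-has-no-hubPair : ¬ ∃₂ (HubPair C⁺ C⁺-adj?)
C⁺-has-no-hubPair = from-no (anySubset? λ A → anySubset? λ B → hubPair? C⁺ C⁺-adj? A B)

lemma2p8 : ¬ (K₂,₄ IsMinorOf C⁺)
lemma2p8 M = C⁺-has-no-hubPair (_ , _ , hubPair C⁺-adj? M)
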